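{- Let $p>q$ be primes. The independent domination polynomial of the zero divisor graph $\Gamma(\mathbb{Z}_{p^{2}q})$ is log-concave but not unimodal.
   Context: For a commutative ring $R$ with identity, the zero divisor graph $\Gamma(R)$ is the simple graph whose vertices are the nonzero zero divisors of $R$, two distinct vertices $a,b$ being adjacent iff $ab=0$. For a graph $G$, a set $S\subseteq V(G)$ is an independent dominating set if its vertices are pairwise non-adjacent and every vertex outside $S$ is adjacent to some vertex of $S$. Let $d_i(G,k)$ be the number of independent dominating sets of size $k$; the independent domination polynomial is $D_i(G,x)=\sum_{k} d_i(G,k)x^k$. A polynomial $\sum_{i=0}^{b}a_ix^i$ of degree $b$ is unimodal if there is an index $t$ with $a_0\le a_1\le\dots\le a_t\ge a_{t+1}\ge\dots\ge a_b$, and log-concave if $a_j^2\ge a_{j-1}a_{j+1}$ for all $1\le j\le b-1$. -}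

module Defs where

open import Data.Bool using (Bool; true; false; _∧_; _∨_; not; if_then_else_)
open import Data.Nat using (ℕ; zero; suc; _+_; _*_; _∸_; _≤_; _<_; _≡ᵇ_)
open import Data.Nat.Divisibility using (_∣?_)
open import Data.Fin using (Fin; toℕ; _≟_)
open import Data.Fin.Subset using (Subset; Side; inside; outside; ∣_∣)
open import Data.Vec using (Vec; []; _∷_; lookup)
open import Data.List using (List; [_]; _++_; map; allFin)
open import Data.Bool.ListAction using (all; any)
open import Data.Nat.ListAction using (sum)
open import Data.Product using (Σ; _×_; ∃-syntax)
open import Relation.Binary.PropositionalEquality using (_≡_; _≢_)
open import Relation.Nullary.Decidable using (⌊_⌋)

-- Elements of ℤ_n are represented by Fin n (residues 0..n-1).
-- a * b = 0 in ℤ_n  iff  n divides (toℕ a * toℕ b).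
zeroProd : (n : ℕ) → Fin n → Fin n → Bool
zeroProd n a b = ⌊ n ∣? (toℕ a * toℕ b) ⌋

isNonzero : {n : ℕ} → Fin n → Bool
isNonzero a = not (toℕ a ≡ᵇ 0)

isVertex : (n : ℕ) → Fin n → Bool
isVertex n a = isNonzero a ∧ any (λ b → isNonzero b ∧ zeroProd n a b) (allFin n)

adjacent : (n : ℕ) → Fin n → Fin n → Bool
adjacent n a b = isVertex n a ∧ isVertex n b ∧ not ⌊ a ≟ b ⌋ ∧ zeroProd n a b

member : {n : ℕ} → Subset n → Fin n → Bool
member S a with lookup S a
... | inside  = true
... | outside = false

_⇒ᵇ_ : Bool → Bool → Bool
x ⇒ᵇ y = not x ∨ y

isIndepDom : (n : ℕ) → Subset n → Bool
isIndepDom n S =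
  all (λ a → member S a ⇒ᵇ isVertex n a) (allFin n)
  ∧ all (λ a → all (λ b → (member S a ∧ member S b) ⇒ᵇ not (adjacent n a b)) (allFin n)) (allFin n)
  ∧ all (λ v → (isVertex n v ∧ not (member S v))
                 ⇒ᵇ any (λ s → member S s ∧ adjacent n s v) (allFin n)) (allFin n)

allSubsets : (n : ℕ) → List (Subset n)
allSubsets zero    = [ [] ]
allSubsets (suc n) = map (inside ∷_) (allSubsets n) ++ map (outside ∷_) (allSubsets n)

dᵢ : (n : ℕ) → ℕ → ℕ
dᵢ n k = sum (map (λ S → if isIndepDom n S ∧ (∣ S ∣ ≡ᵇ k) then 1 else 0) (allSubsets n))

-- A polynomial is given by its coefficient sequence a : ℕ → ℕ (finitely supported).
IsDegree : (ℕ → ℕ) → ℕ → Set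
IsDegree a b = (a b ≢ 0) × (∀ k → b < k → a k ≡ 0)

Unimodal : (ℕ → ℕ) → Set
Unimodal a = ∀ b → IsDegree a b →
  ∃[ t ] (t ≤ b × (∀ i → i < t → a i ≤ a (suc i)) × (∀ i → t ≤ i → i < b → a (suc i) ≤ a i))

LogConcave : (ℕ → ℕ) → Set
LogConcave a = ∀ b → IsDegree a b →
  ∀ j → 1 ≤ j → j ≤ b ∸ 1 → a (j ∸ 1) * a (suc j) ≤ a j * a j

-- Write n = p²q and sort the nonzero zero divisors x of ℤₙ by g = gcd(x, n) ∈ {p, p², q, pq}.
-- As xy ≡ 0 exactly when p² ∣ xy and q ∣ xy, the class g = pq is a clique joined to the classes
-- g = p and g = p², the class g = p² is also joined to g = q, and there are no other edges.  So an
-- independent dominating set is {d} ∪ {g = q} with gcd(d, n) = pq, or {g ∈ {p, p²}}, or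
-- {g ∈ {p, q}}, of sizes p² − p + 1, pq − p and p² + pq − 2p − q + 1.  No two of these exponents
-- are two apart (the last two differ by (p − 1)(q − 1) − 1, and p ≠ 4), so the polynomial is
-- log-concave; but the coefficient of x^(pq − p + 1) vanishes between two nonzero coefficients,
-- so it is not unimodal.

module Submission where

open import Defs
open import Data.Nat using (ℕ; _*_; _<_)
open import Data.Nat.Primality using (Prime)
open import Data.Product using (_×_)
open import Relation.Nullary using (¬_)

open import Data.Bool using (Bool; true; false; T; not; _∧_; _∨_; if_then_else_)
open import Data.Bool.ListAction using (all; any)
open import Data.Bool.Properties using (T-∧)
open import Data.Empty using (⊥-elim)
open import Data.Fin using (Fin; toℕ; fromℕ<) renaming (_≟_ to _≟ᶠ_)
import Data.Fin as Fin
open import Data.Fin.Properties using (toℕ-fromℕ<; toℕ<n; toℕ-injective; any?)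
open import Data.Fin.Subset using (Subset; ∣_∣; inside; outside)
open import Data.List using (List; []; _∷_; map; allFin)
open import Data.List.Membership.Propositional using (_∈_; lose)
open import Data.List.Membership.Propositional.Properties using (∈-allFin; ∈-++⁺ˡ; ∈-++⁺ʳ; ∈-map⁺)
import Data.List.Relation.Unary.All as All
open import Data.List.Relation.Unary.All.Properties using (all⁺; all⁻)
import Data.List.Relation.Unary.Any as Any
open import Data.List.Relation.Unary.Any using (here)
open import Data.List.Relation.Unary.Any.Properties using (any⁺; any⁻)
open import Data.Nat using (zero; suc; pred; _+_; _≤_; _≤?_; _<?_; z≤n; s≤s;
  NonZero; >-nonZero⁻¹; ≢-nonZero⁻¹; nonTrivial⇒n>1)
open import Data.Nat.Divisibility using (_∣_; _∣?_; divides; _∣0; ∣⇒≤; ∣-refl; ∣m+n∣m⇒∣n; ∣m∣n⇒∣m+n;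
  *-pres-∣; *-monoˡ-∣; *-cancelʳ-∣; ∣m⇒∣m*n; ∣n⇒∣m*n; m*n∣⇒m∣; m*n∣⇒n∣; m∣m*n; n∣m*n)
open import Data.Nat.ListAction using (sum)
open import Data.Nat.Primality using (euclidsLemma; prime⇒nonZero; prime⇒nonTrivial; prime⇒irreducible;
  ¬prime[1]; composite⇒¬prime; composite[4])
open import Data.Nat.Properties
open import Data.Nat.Tactic.RingSolver using (solve-∀)
open import Data.Product using (_,_; proj₁; proj₂; ∃-syntax; Σ-syntax; map₂; uncurry; swap)
import Data.Product.Function.Dependent.Propositional as Σ
open import Data.Product.Function.NonDependent.Propositional using (_×-⇔_)
open import Data.Sum using (_⊎_; inj₁; inj₂; [_,_])
import Data.Sum as Sum
open import Data.Vec using ([]; _∷_; lookup; tabulate)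
open import Data.Vec.Properties using (lookup∘tabulate)
open import Function using (_∘_; const)
open import Function.Bundles using (_⇔_; mk⇔; Equivalence)
open import Function.Related.Propositional using (equivalence)
open import Function.Properties.Equivalence using () renaming (refl to ⇔-refl; trans to ⇔-trans; sym to ⇔-sym)
open import Level using (Level; 0ℓ)
open import Relation.Binary.PropositionalEquality
  using (_≡_; _≢_; refl; sym; trans; cong; cong₂; subst; module ≡-Reasoning)
open import Relation.Nullary using (yes; no; contradiction)
open import Relation.Nullary.Decidable using (Dec; does; does-⇔; _×-dec_; decidable-stable; T?;
  ⌊_⌋; toWitness; fromWitness; toWitnessFalse; fromWitnessFalse)
open import Relation.Unary using (Pred; Decidable; _∩_; _∪_; ∁; _⊥_)
open import Relation.Unary.Properties using (_∩?_; _∪?_; ∁?)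

open import Algebra.Properties.CommutativeSemigroup +-commutativeSemigroup using (interchange)
open Equivalence using (to; from)

private
  variable
    ℓ ℓ′ ℓ″ : Level

-- Log-concavity and unimodality of coefficient sequences

module _ {a : ℕ → ℕ} where

  ascending⇒≤ : ∀ {t i j} → (∀ k → k < t → a k ≤ a (suc k)) → i ≤ j → j ≤ t → a i ≤ a j
  ascending⇒≤ {j = zero} _ z≤n _ = ≤-refl
  ascending⇒≤ {j = suc j} asc i≤1+j 1+j≤t with m≤n⇒m<n∨m≡n i≤1+j
  ... | inj₂ refl = ≤-refl
  ... | inj₁ (s≤s i≤j) = ≤-trans (ascending⇒≤ asc i≤j (<⇒≤ 1+j≤t)) (asc j 1+j≤t)

  descending⇒≥ : ∀ {t b i j} → (∀ k → t ≤ k → k < b → a (suc k) ≤ a k) →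
                 t ≤ i → i ≤ j → j ≤ b → a j ≤ a i
  descending⇒≥ {j = zero} _ _ z≤n _ = ≤-refl
  descending⇒≥ {j = suc j} desc t≤i i≤1+j 1+j≤b with m≤n⇒m<n∨m≡n i≤1+j
  ... | inj₂ refl = ≤-refl
  ... | inj₁ (s≤s i≤j) = ≤-trans (desc j (≤-trans t≤i i≤j) 1+j≤b) (descending⇒≥ desc t≤i i≤j (<⇒≤ 1+j≤b))

  nonzero⇒≤degree : ∀ {b k} → IsDegree a b → a k ≢ 0 → k ≤ b
  nonzero⇒≤degree {b} {k} (_ , beyond) ak≢0 with k ≤? b
  ... | yes k≤b = k≤b
  ... | no k≰b = contradiction (beyond k (≰⇒> k≰b)) ak≢0

  internalZero⇒¬unimodal : ∀ {b i k m} → IsDegree a b → i < k → k < m →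
                           a i ≢ 0 → a k ≡ 0 → a m ≢ 0 → ¬ Unimodal a
  internalZero⇒¬unimodal {b} {i} {k} {m} deg i<k k<m ai≢0 ak≡0 am≢0 unimodal
    with unimodal b deg
  ... | t , _ , asc , desc with t ≤? k
  ... | yes t≤k = am≢0 (n≤0⇒n≡0 (subst (a m ≤_) ak≡0
                    (descending⇒≥ desc t≤k (<⇒≤ k<m) (nonzero⇒≤degree deg am≢0))))
  ... | no t≰k = ai≢0 (n≤0⇒n≡0 (subst (a i ≤_) ak≡0
                    (ascending⇒≤ asc (<⇒≤ i<k) (<⇒≤ (≰⇒> t≰k)))))

  sparse⇒logConcave : (∀ j → a j ≡ 0 ⊎ a (2 + j) ≡ 0) → LogConcave a
  sparse⇒logConcave sparse _ _ (suc j) _ _ with sparse j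
  ... | inj₁ aj≡0 rewrite aj≡0 = z≤n
  ... | inj₂ aj+2≡0 rewrite aj+2≡0 | *-zeroʳ (a j) = z≤n

  module ThreeTerm {e₁ e₂ e₃ : ℕ}
    (support : ∀ k → a k ≢ 0 → k ≡ e₁ ⊎ k ≡ e₂ ⊎ k ≡ e₃)
    (2+e₁<e₂ : 2 + e₁ < e₂) (e₂<e₃ : e₂ < e₃) (e₃≢2+e₂ : e₃ ≢ 2 + e₂) where

    private
      In : ℕ → Set
      In k = k ≡ e₁ ⊎ k ≡ e₂ ⊎ k ≡ e₃

      e₁<e₂ : e₁ < e₂
      e₁<e₂ = <-trans (m≤n⇒m≤1+n (n<1+n e₁)) 2+e₁<e₂

      vanishes-outside : ∀ k → ¬ In k → a k ≡ 0
      vanishes-outside k k∉ with a k ≟ 0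
      ... | yes ak≡0 = ak≡0
      ... | no ak≢0 = contradiction (support k ak≢0) k∉

      not-above : ∀ {x y} → y ≤ x → y ≢ 2 + x
      not-above y≤x = <⇒≢ (s≤s (m≤n⇒m≤1+n y≤x))

      no-two-apart : ∀ {x y} → In x → In y → y ≢ 2 + x
      no-two-apart (inj₁ refl)        (inj₁ refl)        = not-above ≤-refl
      no-two-apart (inj₁ refl)        (inj₂ (inj₁ refl)) = >⇒≢ 2+e₁<e₂
      no-two-apart (inj₁ refl)        (inj₂ (inj₂ refl)) = >⇒≢ (<-trans 2+e₁<e₂ e₂<e₃)
      no-two-apart (inj₂ (inj₁ refl)) (inj₁ refl)        = not-above (<⇒≤ e₁<e₂)
      no-two-apart (inj₂ (inj₁ refl)) (inj₂ (inj₁ refl)) = not-above ≤-refl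
      no-two-apart (inj₂ (inj₁ refl)) (inj₂ (inj₂ refl)) = e₃≢2+e₂
      no-two-apart (inj₂ (inj₂ refl)) (inj₁ refl)        = not-above (<⇒≤ (<-trans e₁<e₂ e₂<e₃))
      no-two-apart (inj₂ (inj₂ refl)) (inj₂ (inj₁ refl)) = not-above (<⇒≤ e₂<e₃)
      no-two-apart (inj₂ (inj₂ refl)) (inj₂ (inj₂ refl)) = not-above ≤-refl

    logConcave : LogConcave a
    logConcave = sparse⇒logConcave sparse
      where
      sparse : ∀ j → a j ≡ 0 ⊎ a (2 + j) ≡ 0
      sparse j with a j ≟ 0 | a (2 + j) ≟ 0
      ... | yes aj≡0 | _ = inj₁ aj≡0
      ... | no _ | yes aj+2≡0 = inj₂ aj+2≡0
      ... | no aj≢0 | no aj+2≢0 = contradiction refl (no-two-apart (support _ aj≢0) (support _ aj+2≢0))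

    ¬unimodal : a e₁ ≢ 0 → a e₃ ≢ 0 → ¬ Unimodal a
    ¬unimodal ae₁≢0 ae₃≢0 =
      internalZero⇒¬unimodal degree (n<1+n e₁) 1+e₁<e₃ ae₁≢0 gap ae₃≢0
      where
      1+e₁<e₃ : suc e₁ < e₃
      1+e₁<e₃ = <-trans (<-trans (n<1+n (suc e₁)) 2+e₁<e₂) e₂<e₃
      ≤e₃ : ∀ {k} → In k → k ≤ e₃
      ≤e₃ (inj₁ refl) = <⇒≤ (<-trans e₁<e₂ e₂<e₃)
      ≤e₃ (inj₂ (inj₁ refl)) = <⇒≤ e₂<e₃
      ≤e₃ (inj₂ (inj₂ refl)) = ≤-refl
      degree : IsDegree a e₃
      degree = ae₃≢0 , λ k e₃<k → vanishes-outside k (λ k∈ → <⇒≱ e₃<k (≤e₃ k∈))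
      gap : a (suc e₁) ≡ 0
      gap = vanishes-outside (suc e₁) λ
        { (inj₁ 1+e₁≡e₁) → 1+n≢n 1+e₁≡e₁
        ; (inj₂ (inj₁ 1+e₁≡e₂)) → <⇒≢ (<-trans (n<1+n (suc e₁)) 2+e₁<e₂) 1+e₁≡e₂
        ; (inj₂ (inj₂ 1+e₁≡e₃)) → <⇒≢ 1+e₁<e₃ 1+e₁≡e₃ }

both : ∀ {A : Set ℓ} {B : Set ℓ′} → A → B → A ⇔ B
both a b = mk⇔ (const b) (const a)

neither : ∀ {A : Set ℓ} {B : Set ℓ′} → ¬ A → ¬ B → A ⇔ B
neither ¬a ¬b = mk⇔ (⊥-elim ∘ ¬a) (⊥-elim ∘ ¬b)

separated-by : ∀ {A : Set} {x y : A} (R : Pred A ℓ) → ¬ R x → R y → x ≢ y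
separated-by R ¬Rx Ry refl = ¬Rx Ry

T-does : ∀ {A : Set ℓ} (A? : Dec A) → T (does A?) ⇔ A
T-does (yes a) = mk⇔ (const a) (const _)
T-does (no ¬a) = mk⇔ (λ ()) ¬a

T-not : ∀ {x} → T (not x) ⇔ (¬ T x)
T-not {true} = mk⇔ (λ ()) (λ ¬t → ¬t _)
T-not {false} = mk⇔ (λ _ ()) (const _)

T-⇒ᵇ : ∀ {x y} → T (x ⇒ᵇ y) ⇔ (T x → T y)
T-⇒ᵇ {true} = mk⇔ const (λ f → f _)
T-⇒ᵇ {false} = mk⇔ (λ _ ()) (const _)

module _ {A : Set} {xs : List A} (exhaustive : ∀ x → x ∈ xs) (f : A → Bool) where

  T-all⇔∀ : T (all f xs) ⇔ (∀ x → T (f x))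
  T-all⇔∀ = mk⇔ (λ t x → All.lookup (all⁺ f xs t) (exhaustive x))
                (λ h → all⁻ f (All.tabulate {xs = xs} (λ {x} _ → h x)))

  T-any⇔∃ : T (any f xs) ⇔ (∃[ x ] T (f x))
  T-any⇔∃ = mk⇔ (Any.satisfied ∘ any⁻ f xs) (λ (x , fx) → any⁺ f (lose (exhaustive x) fx))

T-all-allFin : ∀ {n} (f : Fin n → Bool) → T (all f (allFin n)) ⇔ (∀ a → T (f a))
T-all-allFin = T-all⇔∀ ∈-allFin

T-any-allFin : ∀ {n} (f : Fin n → Bool) → T (any f (allFin n)) ⇔ (∃[ a ] T (f a))
T-any-allFin = T-any⇔∃ ∈-allFin

-- Independent dominating sets of the zero-divisor graph of ℤₙ

T-isNonzero : ∀ {n} (a : Fin n) → T (isNonzero a) ⇔ toℕ a ≢ 0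
T-isNonzero a with toℕ a
... | zero = mk⇔ (λ ()) (λ 0≢0 → 0≢0 refl)
... | suc _ = mk⇔ (λ _ ()) (const _)

T-zeroProd : ∀ {n} (a b : Fin n) → T (zeroProd n a b) ⇔ n ∣ toℕ a * toℕ b
T-zeroProd a b = mk⇔ toWitness fromWitness

T-≢ : ∀ {n} {a b : Fin n} → T (not ⌊ a ≟ᶠ b ⌋) ⇔ a ≢ b
T-≢ = mk⇔ toWitnessFalse fromWitnessFalse

_∈ˢ_ : ∀ {n} → Fin n → Subset n → Set
a ∈ˢ S = T (member S a)

Vertex : (n : ℕ) → Fin n → Set
Vertex n a = toℕ a ≢ 0 × Σ[ b ∈ Fin n ] toℕ b ≢ 0 × n ∣ toℕ a * toℕ b

T-isVertex : ∀ {n} (a : Fin n) → T (isVertex n a) ⇔ Vertex n a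
T-isVertex {n} a =
  ⇔-trans T-∧ (T-isNonzero a ×-⇔ ⇔-trans (T-any-allFin _) (Σ.congˡ {k = equivalence} λ {b} → annihilates b))
  where
  annihilates : ∀ b → T (isNonzero b ∧ zeroProd n a b) ⇔ (toℕ b ≢ 0 × n ∣ toℕ a * toℕ b)
  annihilates b = ⇔-trans T-∧ (T-isNonzero b ×-⇔ T-zeroProd a b)

T-adjacent : ∀ {n} (a b : Fin n) →
             T (adjacent n a b) ⇔ (Vertex n a × Vertex n b × a ≢ b × n ∣ toℕ a * toℕ b)
T-adjacent a b =
  ⇔-trans T-∧ (T-isVertex a ×-⇔ ⇔-trans T-∧ (T-isVertex b ×-⇔ ⇔-trans T-∧ (T-≢ ×-⇔ T-zeroProd a b)))

record IsIndependentDominating (n : ℕ) (S : Subset n) : Set where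
  field
    vertices    : ∀ {a} → a ∈ˢ S → Vertex n a
    independent : ∀ {a b} → a ∈ˢ S → b ∈ˢ S → n ∣ toℕ a * toℕ b → a ≡ b
    dominating  : ∀ {v} → Vertex n v → ¬ v ∈ˢ S → ∃[ s ] s ∈ˢ S × n ∣ toℕ s * toℕ v

module _ {n : ℕ} (S : Subset n) where

  T-members-are-vertices :
    T (all (λ a → member S a ⇒ᵇ isVertex n a) (allFin n)) ⇔ (∀ {a} → a ∈ˢ S → Vertex n a)
  T-members-are-vertices =
    mk⇔ (λ t {a} a∈ → to (T-isVertex a) (to T-⇒ᵇ (to (T-all-allFin _) t a) a∈))
        (λ h → from (T-all-allFin _) λ a → from T-⇒ᵇ λ a∈ → from (T-isVertex a) (h a∈))

  T-members-nonadjacent :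
    T (all (λ a → all (λ b → (member S a ∧ member S b) ⇒ᵇ not (adjacent n a b)) (allFin n)) (allFin n)) ⇔
    (∀ a b → a ∈ˢ S → b ∈ˢ S → ¬ T (adjacent n a b))
  T-members-nonadjacent =
    mk⇔ (λ t a b a∈ b∈ → to T-not (to T-⇒ᵇ (to (T-all-allFin _) (to (T-all-allFin _) t a) b)
                                     (from T-∧ (a∈ , b∈))))
        (λ h → from (T-all-allFin _) λ a → from (T-all-allFin _) λ b → from T-⇒ᵇ λ ab∈ →
          from T-not (uncurry (h a b) (to (T-∧ {member S a}) ab∈)))

  T-nonmembers-dominated :
    T (all (λ v → (isVertex n v ∧ not (member S v)) ⇒ᵇ any (λ s → member S s ∧ adjacent n s v) (allFin n))
           (allFin n)) ⇔
    (∀ v → Vertex n v → ¬ v ∈ˢ S → ∃[ s ] s ∈ˢ S × T (adjacent n s v))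
  T-nonmembers-dominated =
    mk⇔ (λ t v vv v∉ → map₂ (to (T-∧ {member S _})) (to (T-any-allFin _) (to T-⇒ᵇ (to (T-all-allFin _) t v)
                          (from T-∧ (from (T-isVertex v) vv , from T-not v∉)))))
        (λ h → from (T-all-allFin _) λ v → from T-⇒ᵇ λ t → let (vv , v∉) = to (T-∧ {isVertex n v}) t in
          from (T-any-allFin _) (map₂ (from T-∧) (h v (to (T-isVertex v) vv) (to T-not v∉))))

  T-isIndepDom : T (isIndepDom n S) ⇔ IsIndependentDominating n S
  T-isIndepDom = mk⇔ reflect reify
    where
    reflect : T (isIndepDom n S) → IsIndependentDominating n S
    reflect t = record
      { vertices = vertices
      ; independent = independent
      ; dominating = λ {v} vv v∉ → let (s , s∈ , adj) = to T-nonmembers-dominated dominated v vv v∉ in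
                                   s , s∈ , proj₂ (proj₂ (proj₂ (to (T-adjacent s v) adj)))
      }
      where
      t₁ = to T-∧ t
      t₂ = to T-∧ (proj₂ t₁)
      dominated = proj₂ t₂
      vertices : ∀ {a} → a ∈ˢ S → Vertex n a
      vertices = to T-members-are-vertices (proj₁ t₁)
      independent : ∀ {a b} → a ∈ˢ S → b ∈ˢ S → n ∣ toℕ a * toℕ b → a ≡ b
      independent {a} {b} a∈ b∈ ab≡0 with a ≟ᶠ b
      ... | yes a≡b = a≡b
      ... | no a≢b = contradiction (from (T-adjacent a b) (vertices a∈ , vertices b∈ , a≢b , ab≡0))
                                   (to T-members-nonadjacent (proj₁ t₂) a b a∈ b∈)

    reify : IsIndependentDominating n S → T (isIndepDom n S)
    reify ids = from T-∧ (from T-members-are-vertices vertices ,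
                 from T-∧ (from T-members-nonadjacent nonadjacent , from T-nonmembers-dominated dominated))
      where
      open IsIndependentDominating ids
      nonadjacent : ∀ a b → a ∈ˢ S → b ∈ˢ S → ¬ T (adjacent n a b)
      nonadjacent a b a∈ b∈ adj =
        let (_ , _ , a≢b , ab≡0) = to (T-adjacent a b) adj in a≢b (independent a∈ b∈ ab≡0)
      dominated : ∀ v → Vertex n v → ¬ v ∈ˢ S → ∃[ s ] s ∈ˢ S × T (adjacent n s v)
      dominated v vv v∉ = let (s , s∈ , sv≡0) = dominating vv v∉ in
        s , s∈ , from (T-adjacent s v) (vertices s∈ , vv , (λ s≡v → v∉ (subst (_∈ˢ S) s≡v s∈)) , sv≡0)

sum-indicator≢0⇔any : ∀ {A : Set} (f : A → Bool) xs →
                      sum (map (λ x → if f x then 1 else 0) xs) ≢ 0 ⇔ T (any f xs)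
sum-indicator≢0⇔any f [] = mk⇔ (λ 0≢0 → 0≢0 refl) (λ ())
sum-indicator≢0⇔any f (x ∷ xs) with f x
... | true = mk⇔ (const _) (const λ ())
... | false = sum-indicator≢0⇔any f xs

∈-allSubsets : ∀ {n} (S : Subset n) → S ∈ allSubsets n
∈-allSubsets [] = here refl
∈-allSubsets {suc n} (inside ∷ S) = ∈-++⁺ˡ (∈-map⁺ (inside ∷_) (∈-allSubsets S))
∈-allSubsets {suc n} (outside ∷ S) =
  ∈-++⁺ʳ (map (inside ∷_) (allSubsets n)) (∈-map⁺ (outside ∷_) (∈-allSubsets S))

dᵢ≢0⇔ : ∀ n k → dᵢ n k ≢ 0 ⇔ (∃[ S ] T (isIndepDom n S) × ∣ S ∣ ≡ k)
dᵢ≢0⇔ n k = ⇔-trans (sum-indicator≢0⇔any _ (allSubsets n))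
           (⇔-trans (T-any⇔∃ ∈-allSubsets _)
           (mk⇔ (map₂ (map₂ (≡ᵇ⇒≡ _ k) ∘ to T-∧)) (map₂ (from T-∧ ∘ map₂ (≡⇒≡ᵇ _ k)))))

independentDominating⇒dᵢ≢0 : ∀ {n} {S : Subset n} → IsIndependentDominating n S → dᵢ n ∣ S ∣ ≢ 0
independentDominating⇒dᵢ≢0 {n} {S} ids = from (dᵢ≢0⇔ n ∣ S ∣) (S , from (T-isIndepDom S) ids , refl)

≡0⇒∣ : ∀ {m x} → x ≡ 0 → m ∣ x
≡0⇒∣ {m} refl = m ∣0

∤⇒≢0 : ∀ {m x} → ¬ m ∣ x → x ≢ 0
∤⇒≢0 ¬m∣x x≡0 = ¬m∣x (≡0⇒∣ x≡0)

∣∧<⇒≡0 : ∀ {m x} → m ∣ x → x < m → x ≡ 0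
∣∧<⇒≡0 {x = zero} _ _ = refl
∣∧<⇒≡0 {x = suc x} m∣x x<m = contradiction (∣⇒≤ m∣x) (<⇒≱ x<m)

module _ {p : ℕ} (p-prime : Prime p) where

  prime∣*∧∤⇒∣ : ∀ {x y} → p ∣ x * y → ¬ p ∣ x → p ∣ y
  prime∣*∧∤⇒∣ {x} {y} p∣xy ¬p∣x with euclidsLemma x y p-prime p∣xy
  ... | inj₁ p∣x = contradiction p∣x ¬p∣x
  ... | inj₂ p∣y = p∣y

  prime²∣*∧∤⇒prime²∣ : ∀ {x y} → p * p ∣ x * y → ¬ p ∣ x → p * p ∣ y
  prime²∣*∧∤⇒prime²∣ {x} p²∣xy ¬p∣x with prime∣*∧∤⇒∣ (m*n∣⇒m∣ p p p²∣xy) ¬p∣x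
  ... | divides k refl = *-monoˡ-∣ p (prime∣*∧∤⇒∣ p∣xk ¬p∣x)
    where
    instance _ = prime⇒nonZero p-prime
    p∣xk : p ∣ x * k
    p∣xk = *-cancelʳ-∣ p (subst (p * p ∣_) (sym (*-assoc x k p)) p²∣xy)

  ∣∧prime∣⇒*∣ : ∀ {m x} → ¬ p ∣ m → m ∣ x → p ∣ x → m * p ∣ x
  ∣∧prime∣⇒*∣ {m} ¬p∣m (divides c refl) p∣cm with euclidsLemma c m p-prime p∣cm
  ... | inj₁ (divides d refl) = divides d (trans (*-assoc d p m) (cong (d *_) (*-comm p m)))
  ... | inj₂ p∣m = contradiction p∣m ¬p∣m

m*k≢3 : ∀ {m k} → 1 ≤ k → k < m → m ≢ 3 → m * k ≢ 3
m*k≢3 {m} {suc zero} _ _ m≢3 m*1≡3 = m≢3 (trans (sym (*-identityʳ m)) m*1≡3)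
m*k≢3 {m} {suc (suc k)} _ 2+k<m _ = >⇒≢ (<-≤-trans (toWitness {a? = 3 <? 6} _) (*-mono-≤ 3≤m (s≤s (s≤s z≤n))))
  where
  3≤m : 3 ≤ m
  3≤m = ≤-trans (s≤s (s≤s (s≤s z≤n))) 2+k<m

-- Counting residues

member≡lookup : ∀ {n} (S : Subset n) a → member S a ≡ lookup S a
member≡lookup S a with lookup S a
... | inside = refl
... | outside = refl

∈ˢ⇔lookup : ∀ {n} (S : Subset n) a → a ∈ˢ S ⇔ T (lookup S a)
∈ˢ⇔lookup S a rewrite member≡lookup S a = ⇔-refl

Represents : ∀ {n} → Subset n → Pred ℕ ℓ → Set ℓ
Represents S P = ∀ a → a ∈ˢ S ⇔ P (toℕ a)

represent : ∀ {n} {P : Pred ℕ ℓ} → Decidable P → Σ[ S ∈ Subset n ] Represents S P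
represent {n = n} {P = P} P? = S , λ a → ⇔-trans (∈ˢ⇔lookup S a)
  (subst (λ b → T b ⇔ P (toℕ a)) (sym (lookup∘tabulate (does ∘ P? ∘ toℕ) a)) (T-does (P? (toℕ a))))
  where
  S : Subset n
  S = tabulate (does ∘ P? ∘ toℕ)

represented-element : ∀ {n} {S : Subset n} {P : Pred ℕ ℓ} {Q : Pred ℕ ℓ′} → Represents S P →
          ∀ {x} → x < n → P x → Q x → ∃[ s ] s ∈ˢ S × Q (toℕ s)
represented-element {P = P} {Q} rep x<n Px Qx = fromℕ< x<n ,
  from (rep _) (subst P (sym (toℕ-fromℕ< x<n)) Px) , subst Q (sym (toℕ-fromℕ< x<n)) Qx

𝟙 : Bool → ℕ
𝟙 b = if b then 1 else 0

count : ∀ {P : Pred ℕ ℓ} → Decidable P → ℕ → ℕ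
count P? zero = 0
count P? (suc N) = 𝟙 (does (P? 0)) + count (P? ∘ suc) N

count-cong : ∀ {P : Pred ℕ ℓ} {Q : Pred ℕ ℓ′} (P? : Decidable P) (Q? : Decidable Q) N →
             (∀ {x} → x < N → P x ⇔ Q x) → count P? N ≡ count Q? N
count-cong P? Q? zero _ = refl
count-cong P? Q? (suc N) P⇔Q = cong₂ _+_ (cong 𝟙 (does-⇔ (P⇔Q (s≤s z≤n)) (P? 0) (Q? 0)))
                                         (count-cong (P? ∘ suc) (Q? ∘ suc) N (P⇔Q ∘ s≤s))

count-none : ∀ {P : Pred ℕ ℓ} (P? : Decidable P) N → (∀ {x} → x < N → ¬ P x) → count P? N ≡ 0
count-none P? zero _ = refl
count-none P? (suc N) ¬P with P? 0
... | yes P0 = contradiction P0 (¬P (s≤s z≤n))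
... | no _ = count-none (P? ∘ suc) N (¬P ∘ s≤s)

count-++ : ∀ {P : Pred ℕ ℓ} (P? : Decidable P) M N →
           count P? (M + N) ≡ count P? M + count (λ x → P? (M + x)) N
count-++ P? zero N = refl
count-++ P? (suc M) N =
  trans (cong (head +_) (count-++ (P? ∘ suc) M N)) (sym (+-assoc head (count (P? ∘ suc) M) _))
  where head = 𝟙 (does (P? 0))

count-additive : ∀ {P : Pred ℕ ℓ} {Q : Pred ℕ ℓ′} {R : Pred ℕ ℓ″}
                 (P? : Decidable P) (Q? : Decidable Q) (R? : Decidable R) →
                 (∀ x → 𝟙 (does (R? x)) ≡ 𝟙 (does (P? x)) + 𝟙 (does (Q? x))) →
                 ∀ N → count R? N ≡ count P? N + count Q? N
count-additive P? Q? R? pointwise zero = refl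
count-additive P? Q? R? pointwise (suc N) = begin
  r + count (R? ∘ suc) N
    ≡⟨ cong₂ _+_ (pointwise 0) (count-additive (P? ∘ suc) (Q? ∘ suc) (R? ∘ suc) (pointwise ∘ suc) N) ⟩
  (p + q) + (count (P? ∘ suc) N + count (Q? ∘ suc) N) ≡⟨ interchange p q _ _ ⟩
  (p + count (P? ∘ suc) N) + (q + count (Q? ∘ suc) N) ∎
  where
  open ≡-Reasoning
  p = 𝟙 (does (P? 0))
  q = 𝟙 (does (Q? 0))
  r = 𝟙 (does (R? 0))

count-∩∁ : ∀ {P : Pred ℕ ℓ} {Q : Pred ℕ ℓ′} (P? : Decidable P) (Q? : Decidable Q) N →
           count P? N ≡ count (P? ∩? Q?) N + count (P? ∩? ∁? Q?) N
count-∩∁ P? Q? = count-additive (P? ∩? Q?) (P? ∩? ∁? Q?) P? (λ x → split (does (P? x)) (does (Q? x)))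
  where
  split : ∀ a b → 𝟙 a ≡ 𝟙 (a ∧ b) + 𝟙 (a ∧ not b)
  split false _ = refl
  split true true = refl
  split true false = refl

count-∖ : ∀ {P : Pred ℕ ℓ} {Q : Pred ℕ ℓ′} (P? : Decidable P) (Q? : Decidable Q) N {k m} →
          count P? N ≡ k + m → count (P? ∩? Q?) N ≡ k → count (P? ∩? ∁? Q?) N ≡ m
count-∖ P? Q? N {k} total common = +-cancelˡ-≡ k _ _ (begin
  k + count (P? ∩? ∁? Q?) N                         ≡⟨ cong (_+ count (P? ∩? ∁? Q?) N) common ⟨
  count (P? ∩? Q?) N + count (P? ∩? ∁? Q?) N        ≡⟨ count-∩∁ P? Q? N ⟨
  count P? N                                        ≡⟨ total ⟩
  k + _                                             ∎)
  where open ≡-Reasoning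

count-∪ : ∀ {P Q : Pred ℕ ℓ} (P? : Decidable P) (Q? : Decidable Q) → P ⊥ Q → ∀ N →
          count (P? ∪? Q?) N ≡ count P? N + count Q? N
count-∪ P? Q? disjoint = count-additive P? Q? (P? ∪? Q?) pointwise
  where
  pointwise : ∀ x → 𝟙 (does (P? x) ∨ does (Q? x)) ≡ 𝟙 (does (P? x)) + 𝟙 (does (Q? x))
  pointwise x with P? x | Q? x
  ... | yes Px | yes Qx = contradiction (Px , Qx) disjoint
  ... | yes _ | no _ = refl
  ... | no _ | _ = refl

count-singleton : ∀ {d N} → d < N → count (_≟ d) N ≡ 1
count-singleton {zero} {suc N} _ = cong suc (count-none (λ x → suc x ≟ 0) N (λ _ ()))
count-singleton {suc d} {suc N} (s≤s d<N) =
  trans (count-cong (λ x → suc x ≟ suc d) (_≟ d) N (λ _ → mk⇔ suc-injective (cong suc))) (count-singleton d<N)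

count-multiples : ∀ m .{{_ : NonZero m}} k → count (m ∣?_) (k * m) ≡ k
count-multiples m zero = refl
count-multiples m (suc k) = begin
  count (m ∣?_) (m + k * m)                                ≡⟨ count-++ (m ∣?_) m (k * m) ⟩
  count (m ∣?_) m + count (λ x → m ∣? (m + x)) (k * m)     ≡⟨ cong₂ _+_ first-period later-periods ⟩
  1 + k                                                    ∎
  where
  open ≡-Reasoning
  first-period : count (m ∣?_) m ≡ 1
  first-period = trans (count-cong (m ∣?_) (_≟ 0) m λ x<m → mk⇔ (λ m∣x → ∣∧<⇒≡0 m∣x x<m) ≡0⇒∣)
                       (count-singleton (>-nonZero⁻¹ m))
  later-periods : count (λ x → m ∣? (m + x)) (k * m) ≡ k
  later-periods = trans (count-cong (λ x → m ∣? (m + x)) (m ∣?_) (k * m) λ _ →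
                           mk⇔ (λ m∣m+x → ∣m+n∣m⇒∣n m∣m+x ∣-refl) (∣m∣n⇒∣m+n ∣-refl))
                        (count-multiples m k)

∣S∣≡count : ∀ {n} (S : Subset n) {P : Pred ℕ ℓ} (P? : Decidable P) → Represents S P → ∣ S ∣ ≡ count P? n
∣S∣≡count [] P? _ = refl
∣S∣≡count (s ∷ S) {P} P? rep = trans (∣s∷S∣ s) (cong₂ _+_ head (∣S∣≡count S (P? ∘ suc) tail))
  where
  ∣s∷S∣ : ∀ s → ∣ s ∷ S ∣ ≡ 𝟙 s + ∣ S ∣
  ∣s∷S∣ inside = refl
  ∣s∷S∣ outside = refl
  head : 𝟙 s ≡ 𝟙 (does (P? 0))
  head = cong 𝟙 (does-⇔ (⇔-trans (⇔-sym (∈ˢ⇔lookup (s ∷ S) Fin.zero)) (rep Fin.zero)) (T? s) (P? 0))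
  tail : Represents S (P ∘ suc)
  tail a = ⇔-trans (∈ˢ⇔lookup S a) (⇔-trans (⇔-sym (∈ˢ⇔lookup (s ∷ S) (Fin.suc a))) (rep (Fin.suc a)))

-- The zero-divisor graph of ℤ_{p²q}

module ZeroDivisorGraph {p q : ℕ} (p-prime : Prime p) (q-prime : Prime q) (q<p : q < p) where

  n : ℕ
  n = p * p * q

  instance
    p≢0 : NonZero p
    p≢0 = prime⇒nonZero p-prime
    q≢0 : NonZero q
    q≢0 = prime⇒nonZero q-prime
    p²≢0 : NonZero (p * p)
    p²≢0 = m*n≢0 p p
    pq≢0 : NonZero (p * q)
    pq≢0 = m*n≢0 p q
    n≢0 : NonZero n
    n≢0 = m*n≢0 (p * p) q

  q∤p : ¬ q ∣ p
  q∤p q∣p with prime⇒irreducible p-prime q∣p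
  ... | inj₁ q≡1 = contradiction (subst Prime q≡1 q-prime) ¬prime[1]
  ... | inj₂ q≡p = <⇒≢ q<p q≡p

  p∤q : ¬ p ∣ q
  p∤q p∣q = <⇒≱ q<p (∣⇒≤ p∣q)

  q∤p² : ¬ q ∣ p * p
  q∤p² q∣p² = q∤p (prime∣*∧∤⇒∣ q-prime q∣p² q∤p)

  1<q : 1 < q
  1<q = nonTrivial⇒n>1 q {{prime⇒nonTrivial q-prime}}

  1<p : 1 < p
  1<p = <-trans 1<q q<p

  p²∤p : ¬ p * p ∣ p
  p²∤p p²∣p = <⇒≱ (m<m*n p p 1<p) (∣⇒≤ p²∣p)

  p²<n : p * p < n
  p²<n = m<m*n (p * p) q 1<q

  p<n : p < n
  p<n = <-trans (m<m*n p p 1<p) p²<n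

  q<n : q < n
  q<n = <-trans q<p p<n

  pq<n : p * q < n
  pq<n = subst (p * q <_) (pqp≡ppq p q) (m<m*n (p * q) p 1<p)
    where
    pqp≡ppq : ∀ p q → p * q * p ≡ p * p * q
    pqp≡ppq = solve-∀

  p²∣∧q∣⇒n∣ : ∀ {x} → p * p ∣ x → q ∣ x → n ∣ x
  p²∣∧q∣⇒n∣ = ∣∧prime∣⇒*∣ q-prime q∤p²

  residue≡0 : ∀ {x} → x < n → p * p ∣ x → q ∣ x → x ≡ 0
  residue≡0 x<n p²∣x q∣x = ∣∧<⇒≡0 (p²∣∧q∣⇒n∣ p²∣x q∣x) x<n

  module _ {s x : ℕ} (n∣sx : n ∣ s * x) where

    p∤⇒p²∣ann : ¬ p ∣ x → p * p ∣ s
    p∤⇒p²∣ann = prime²∣*∧∤⇒prime²∣ p-prime (subst (p * p ∣_) (*-comm s x) (m*n∣⇒m∣ (p * p) q n∣sx))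

    q∤⇒q∣ann : ¬ q ∣ x → q ∣ s
    q∤⇒q∣ann = prime∣*∧∤⇒∣ q-prime (subst (q ∣_) (*-comm s x) (m*n∣⇒n∣ (p * p) q n∣sx))

    p²∤⇒p∣ann : ¬ p * p ∣ x → p ∣ s
    p²∤⇒p∣ann ¬p²∣x with p ∣? s
    ... | yes p∣s = p∣s
    ... | no ¬p∣s = contradiction (prime²∣*∧∤⇒prime²∣ p-prime (m*n∣⇒m∣ (p * p) q n∣sx) ¬p∣s) ¬p²∣x

  vertex⇔ : ∀ {a : Fin n} → Vertex n a ⇔ (toℕ a ≢ 0 × ((p ∣ toℕ a) ⊎ (q ∣ toℕ a)))
  vertex⇔ {a} = mk⇔ (map₂ divisor) (map₂ annihilator)
    where
    x = toℕ a

    divisor : (Σ[ b ∈ Fin n ] toℕ b ≢ 0 × n ∣ x * toℕ b) → (p ∣ x) ⊎ (q ∣ x)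
    divisor (b , b≢0 , n∣xb) with p ∣? x | q ∣? x
    ... | yes p∣x | _ = inj₁ p∣x
    ... | no _ | yes q∣x = inj₂ q∣x
    ... | no ¬p∣x | no ¬q∣x =
      contradiction (residue≡0 (toℕ<n b) (p∤⇒p²∣ann n∣bx ¬p∣x) (q∤⇒q∣ann n∣bx ¬q∣x)) b≢0
      where n∣bx = subst (n ∣_) (*-comm x (toℕ b)) n∣xb

    residue : ∀ {y} → y < n → y ≢ 0 → n ∣ x * y → Σ[ b ∈ Fin n ] toℕ b ≢ 0 × n ∣ x * toℕ b
    residue y<n y≢0 n∣xy = fromℕ< y<n , subst (_≢ 0) (sym (toℕ-fromℕ< y<n)) y≢0 ,
                           subst (λ y → n ∣ x * y) (sym (toℕ-fromℕ< y<n)) n∣xy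

    annihilator : (p ∣ x) ⊎ (q ∣ x) → Σ[ b ∈ Fin n ] toℕ b ≢ 0 × n ∣ x * toℕ b
    annihilator (inj₁ p∣x) = residue pq<n (≢-nonZero⁻¹ (p * q))
      (p²∣∧q∣⇒n∣ (*-pres-∣ p∣x (m∣m*n q)) (∣n⇒∣m*n x (n∣m*n p)))
    annihilator (inj₂ q∣x) = residue p²<n (≢-nonZero⁻¹ (p * p))
      (p²∣∧q∣⇒n∣ (∣n⇒∣m*n x ∣-refl) (∣m⇒∣m*n (p * p) q∣x))

  -- For a residue x < n, the constructor records gcd(x, n).
  data Kind (x : ℕ) : Set where
    gcd-n  : x ≡ 0 → Kind x
    gcd-1  : ¬ p ∣ x → ¬ q ∣ x → Kind x
    gcd-p  : p ∣ x → ¬ p * p ∣ x → ¬ q ∣ x → Kind x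
    gcd-p² : p * p ∣ x → ¬ q ∣ x → Kind x
    gcd-q  : ¬ p ∣ x → q ∣ x → Kind x
    gcd-pq : p ∣ x → q ∣ x → x ≢ 0 → Kind x

  kind : ∀ x → Kind x
  kind zero = gcd-n refl
  kind x@(suc _) with p ∣? x | q ∣? x
  ... | no ¬p∣x | no ¬q∣x = gcd-1 ¬p∣x ¬q∣x
  ... | no ¬p∣x | yes q∣x = gcd-q ¬p∣x q∣x
  ... | yes p∣x | yes q∣x = gcd-pq p∣x q∣x (λ ())
  ... | yes p∣x | no ¬q∣x with p * p ∣? x
  ...   | yes p²∣x = gcd-p² p²∣x ¬q∣x
  ...   | no ¬p²∣x = gcd-p p∣x ¬p²∣x ¬q∣x

  -- With g = gcd(x, n): P∖Q is g ∈ {p, p²}, Q∖P is g = q, and P∖Q∖P² is g = p.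
  P∖Q Q∖P P∖Q∖P² : Pred ℕ 0ℓ
  P∖Q = (p ∣_) ∩ ∁ (q ∣_)
  Q∖P = (q ∣_) ∩ ∁ (p ∣_)
  P∖Q∖P² = P∖Q ∩ ∁ (p * p ∣_)

  P∖Q? : Decidable P∖Q
  P∖Q? = (p ∣?_) ∩? ∁? (q ∣?_)

  Q∖P? : Decidable Q∖P
  Q∖P? = (q ∣?_) ∩? ∁? (p ∣?_)

  P∖Q∖P²? : Decidable P∖Q∖P²
  P∖Q∖P²? = P∖Q? ∩? ∁? (p * p ∣?_)

  module Classification {S : Subset n} (ids : IsIndependentDominating n S) where
    open IsIndependentDominating ids

    private
      vertex : ∀ {a} → toℕ a ≢ 0 → (p ∣ toℕ a) ⊎ (q ∣ toℕ a) → Vertex n a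
      vertex a≢0 p∣⊎q∣ = from vertex⇔ (a≢0 , p∣⊎q∣)

      zero∉ : ∀ {a} → toℕ a ≡ 0 → ¬ a ∈ˢ S
      zero∉ a≡0 a∈ = proj₁ (vertices a∈) a≡0

      unit∉ : ∀ {a} → ¬ p ∣ toℕ a → ¬ q ∣ toℕ a → ¬ a ∈ˢ S
      unit∉ ¬p∣a ¬q∣a a∈ = [ ¬p∣a , ¬q∣a ] (proj₂ (to vertex⇔ (vertices a∈)))

      annihilated∉ : ∀ {s a} → s ∈ˢ S → n ∣ toℕ s * toℕ a → toℕ a ≢ toℕ s → ¬ a ∈ˢ S
      annihilated∉ s∈ n∣sa a≢s a∈ = a≢s (cong toℕ (sym (independent s∈ a∈ n∣sa)))

      unannihilated∈ : ∀ {a} → Vertex n a → (∀ {s} → s ∈ˢ S → ¬ n ∣ toℕ s * toℕ a) → a ∈ˢ S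
      unannihilated∈ va unannihilated = decidable-stable (T? _) λ a∉ →
        let (s , s∈ , n∣sa) = dominating va a∉ in unannihilated s∈ n∣sa

    module _ {d} (d∈ : d ∈ˢ S) (p∣d : p ∣ toℕ d) (q∣d : q ∣ toℕ d) where

      private
        d≢0 : toℕ d ≢ 0
        d≢0 = proj₁ (vertices d∈)

        ann-by-d : ∀ {x} → p * p ∣ toℕ d * x → n ∣ toℕ d * x
        ann-by-d p²∣da = p²∣∧q∣⇒n∣ p²∣da (∣m⇒∣m*n _ q∣d)

        ¬G-p∣ : ∀ {x} → p ∣ x → x ≢ toℕ d → ¬ ((_≡ toℕ d) ∪ Q∖P) x
        ¬G-p∣ p∣x x≢d = [ x≢d , (λ (_ , ¬p∣x) → ¬p∣x p∣x) ]

        ¬G-q∤ : ∀ {x} → ¬ q ∣ x → ¬ ((_≡ toℕ d) ∪ Q∖P) x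
        ¬G-q∤ ¬q∣x = [ (λ x≡d → ¬q∣x (subst (q ∣_) (sym x≡d) q∣d)) , ¬q∣x ∘ proj₁ ]

      pqMember⇒ : Represents S ((_≡ toℕ d) ∪ Q∖P)
      pqMember⇒ a with kind (toℕ a)
      ... | gcd-n a≡0 = neither (zero∉ a≡0) (¬G-p∣ (≡0⇒∣ a≡0) λ a≡d → d≢0 (trans (sym a≡d) a≡0))
      ... | gcd-1 ¬p∣a ¬q∣a = neither (unit∉ ¬p∣a ¬q∣a) (¬G-q∤ ¬q∣a)
      ... | gcd-p p∣a _ ¬q∣a =
        neither (annihilated∉ d∈ (ann-by-d (*-pres-∣ p∣d p∣a)) (separated-by (q ∣_) ¬q∣a q∣d)) (¬G-q∤ ¬q∣a)
      ... | gcd-p² p²∣a ¬q∣a =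
        neither (annihilated∉ d∈ (ann-by-d (∣n⇒∣m*n (toℕ d) p²∣a)) (separated-by (q ∣_) ¬q∣a q∣d)) (¬G-q∤ ¬q∣a)
      ... | gcd-pq p∣a q∣a _ with toℕ a ≟ toℕ d
      ...   | yes a≡d = both (subst (_∈ˢ S) (sym (toℕ-injective a≡d)) d∈) (inj₁ a≡d)
      ...   | no a≢d = neither (annihilated∉ d∈ (ann-by-d (*-pres-∣ p∣d p∣a)) a≢d) (¬G-p∣ p∣a a≢d)
      pqMember⇒ a | gcd-q ¬p∣a q∣a =
        both (unannihilated∈ (vertex (∤⇒≢0 ¬p∣a) (inj₂ q∣a)) unannihilated) (inj₂ (q∣a , ¬p∣a))
        where
        -- an annihilator s of a is divisible by p², so d and s annihilate each other
        unannihilated : ∀ {s} → s ∈ˢ S → ¬ n ∣ toℕ s * toℕ a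
        unannihilated {s} s∈ n∣sa = d≢0 (residue≡0 (toℕ<n d) p²∣d q∣d)
          where
          p²∣s = p∤⇒p²∣ann n∣sa ¬p∣a
          p²∣d = subst (λ y → p * p ∣ toℕ y) (sym (independent d∈ s∈ (ann-by-d (∣n⇒∣m*n (toℕ d) p²∣s)))) p²∣s

    module _ (no-pq-member : ∀ {a} → a ∈ˢ S → p ∣ toℕ a → ¬ q ∣ toℕ a) where

      p²Member⇒ : ∀ {r} → r ∈ˢ S → p * p ∣ toℕ r → Represents S P∖Q
      p²Member⇒ {r} r∈ p²∣r a with kind (toℕ a)
      ... | gcd-n a≡0 = neither (zero∉ a≡0) (λ (_ , ¬q∣a) → ¬q∣a (≡0⇒∣ a≡0))
      ... | gcd-1 ¬p∣a ¬q∣a = neither (unit∉ ¬p∣a ¬q∣a) (¬p∣a ∘ proj₁)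
      ... | gcd-pq p∣a q∣a _ = neither (λ a∈ → no-pq-member a∈ p∣a q∣a) (λ (_ , ¬q∣a) → ¬q∣a q∣a)
      ... | gcd-q ¬p∣a q∣a = neither
        (annihilated∉ r∈ (p²∣∧q∣⇒n∣ (∣m⇒∣m*n _ p²∣r) (∣n⇒∣m*n (toℕ r) q∣a))
                         (separated-by (p ∣_) ¬p∣a (m*n∣⇒m∣ p p p²∣r)))
        (¬p∣a ∘ proj₁)
      ... | gcd-p p∣a ¬p²∣a ¬q∣a = both
        (unannihilated∈ (vertex (∤⇒≢0 ¬q∣a) (inj₁ p∣a)) λ s∈ n∣sa →
          no-pq-member s∈ (p²∤⇒p∣ann n∣sa ¬p²∣a) (q∤⇒q∣ann n∣sa ¬q∣a))
        (p∣a , ¬q∣a)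
      ... | gcd-p² p²∣a ¬q∣a = both (unannihilated∈ (vertex (∤⇒≢0 ¬q∣a) (inj₁ p∣a)) unannihilated) (p∣a , ¬q∣a)
        where
        p∣a = m*n∣⇒m∣ p p p²∣a
        -- an annihilator s of a is divisible by q; if p ∤ s, then s also annihilates r
        unannihilated : ∀ {s} → s ∈ˢ S → ¬ n ∣ toℕ s * toℕ a
        unannihilated {s} s∈ n∣sa = no-pq-member s∈ p∣s q∣s
          where
          q∣s = q∤⇒q∣ann n∣sa ¬q∣a
          p∣s : p ∣ toℕ s
          p∣s with p ∣? toℕ s
          ... | yes p∣s = p∣s
          ... | no ¬p∣s = contradiction (subst (λ y → p ∣ toℕ y) r≡s (m*n∣⇒m∣ p p p²∣r)) ¬p∣s
            where r≡s = independent r∈ s∈ (p²∣∧q∣⇒n∣ (∣m⇒∣m*n _ p²∣r) (∣n⇒∣m*n (toℕ r) q∣s))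

      noP²Member⇒ : (∀ {a} → a ∈ˢ S → ¬ p * p ∣ toℕ a) → Represents S (P∖Q∖P² ∪ Q∖P)
      noP²Member⇒ no-p²-member a with kind (toℕ a)
      ... | gcd-n a≡0 = neither (zero∉ a≡0)
        [ (λ ((_ , ¬q∣a) , _) → ¬q∣a (≡0⇒∣ a≡0)) , (λ (_ , ¬p∣a) → ¬p∣a (≡0⇒∣ a≡0)) ]
      ... | gcd-1 ¬p∣a ¬q∣a = neither (unit∉ ¬p∣a ¬q∣a) [ ¬p∣a ∘ proj₁ ∘ proj₁ , ¬q∣a ∘ proj₁ ]
      ... | gcd-pq p∣a q∣a _ = neither (λ a∈ → no-pq-member a∈ p∣a q∣a)
        [ (λ ((_ , ¬q∣a) , _) → ¬q∣a q∣a) , (λ (_ , ¬p∣a) → ¬p∣a p∣a) ]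
      ... | gcd-p² p²∣a _ = neither (λ a∈ → no-p²-member a∈ p²∣a)
        [ (λ (_ , ¬p²∣a) → ¬p²∣a p²∣a) , (λ (_ , ¬p∣a) → ¬p∣a (m*n∣⇒m∣ p p p²∣a)) ]
      ... | gcd-q ¬p∣a q∣a = both
        (unannihilated∈ (vertex (∤⇒≢0 ¬p∣a) (inj₂ q∣a)) λ s∈ n∣sa → no-p²-member s∈ (p∤⇒p²∣ann n∣sa ¬p∣a))
        (inj₂ (q∣a , ¬p∣a))
      ... | gcd-p p∣a ¬p²∣a ¬q∣a = both
        (unannihilated∈ (vertex (∤⇒≢0 ¬q∣a) (inj₁ p∣a)) λ s∈ n∣sa →
          no-pq-member s∈ (p²∤⇒p∣ann n∣sa ¬p²∣a) (q∤⇒q∣ann n∣sa ¬q∣a))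
        (inj₁ ((p∣a , ¬q∣a) , ¬p²∣a))

      withoutPqMember : Represents S P∖Q ⊎ Represents S (P∖Q∖P² ∪ Q∖P)
      withoutPqMember with any? (λ a → T? (member S a) ×-dec p * p ∣? toℕ a)
      ... | yes (r , r∈ , p²∣r) = inj₁ (p²Member⇒ r∈ p²∣r)
      ... | no ∄p² = inj₂ (noP²Member⇒ λ {a} a∈ p²∣a → ∄p² (a , a∈ , p²∣a))

    classification : Represents S P∖Q
                   ⊎ (Σ[ d ∈ Fin n ] p ∣ toℕ d × Represents S ((_≡ toℕ d) ∪ Q∖P))
                   ⊎ Represents S (P∖Q∖P² ∪ Q∖P)
    classification with any? (λ a → T? (member S a) ×-dec p ∣? toℕ a ×-dec q ∣? toℕ a)
    ... | yes (d , d∈ , p∣d , q∣d) = inj₂ (inj₁ (d , p∣d , pqMember⇒ d∈ p∣d q∣d))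
    ... | no ∄pq = Sum.map₂ inj₂ (withoutPqMember λ {a} a∈ p∣a q∣a → ∄pq (a , a∈ , p∣a , q∣a))

  p′ q′ : ℕ
  p′ = pred p
  q′ = pred q

  -- In ordinary notation e₁ = pq − p, e₂ = p² − p + 1 and e₃ = p² + pq − 2p − q + 1.
  e₁ e₂ e₃ : ℕ
  e₁ = p * q′
  e₂ = suc (p * p′)
  e₃ = p′ * q′ + p * p′

  private
    *-pred : ∀ m k .{{_ : NonZero k}} → m * k ≡ m + m * pred k
    *-pred m k = trans (cong (m *_) (sym (suc-pred k))) (*-suc m (pred k))

    #multiples : ∀ m .{{_ : NonZero m}} k → k * m ≡ n → count (m ∣?_) n ≡ k
    #multiples m k k*m≡n = subst (λ N → count (m ∣?_) N ≡ k) k*m≡n (count-multiples m k)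

    #P∩Q : count ((p ∣?_) ∩? (q ∣?_)) n ≡ p
    #P∩Q = trans (count-cong _ (p * q ∣?_) n λ _ →
                   mk⇔ (uncurry (∣∧prime∣⇒*∣ q-prime q∤p)) (λ pq∣x → m*n∣⇒m∣ p q pq∣x , m*n∣⇒n∣ p q pq∣x))
                 (#multiples (p * q) p (sym (*-assoc p p q)))

    #Q∩P : count ((q ∣?_) ∩? (p ∣?_)) n ≡ p
    #Q∩P = trans (count-cong _ ((p ∣?_) ∩? (q ∣?_)) n λ _ → mk⇔ swap swap) #P∩Q

    #P²∩Q : count ((p * p ∣?_) ∩? (q ∣?_)) n ≡ 1
    #P²∩Q = trans (count-cong _ (n ∣?_) n λ _ →
                    mk⇔ (uncurry p²∣∧q∣⇒n∣) (λ n∣x → m*n∣⇒m∣ (p * p) q n∣x , m*n∣⇒n∣ (p * p) q n∣x))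
                  (#multiples n 1 (*-identityˡ n))

    #P²∖Q : count ((p * p ∣?_) ∩? ∁? (q ∣?_)) n ≡ q′
    #P²∖Q = count-∖ (p * p ∣?_) (q ∣?_) n
      (trans (#multiples (p * p) q (*-comm q (p * p))) (sym (suc-pred q))) #P²∩Q

    #P∖Q∩P² : count (P∖Q? ∩? (p * p ∣?_)) n ≡ q′
    #P∖Q∩P² = trans (count-cong _ ((p * p ∣?_) ∩? ∁? (q ∣?_)) n λ _ →
                      mk⇔ (λ ((_ , ¬q∣x) , p²∣x) → p²∣x , ¬q∣x)
                          (λ (p²∣x , ¬q∣x) → (m*n∣⇒m∣ p p p²∣x , ¬q∣x) , p²∣x))
                    #P²∖Q

  #P∖Q : count P∖Q? n ≡ p * q′
  #P∖Q = count-∖ (p ∣?_) (q ∣?_) n (trans (#multiples p (p * q) (pqp≡ppq p q)) (*-pred p q)) #P∩Q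
    where
    pqp≡ppq : ∀ p q → p * q * p ≡ p * p * q
    pqp≡ppq = solve-∀

  #Q∖P : count Q∖P? n ≡ p * p′
  #Q∖P = count-∖ (q ∣?_) (p ∣?_) n (trans (#multiples q (p * p) refl) (*-pred p p)) #Q∩P

  #P∖Q∖P² : count P∖Q∖P²? n ≡ p′ * q′
  #P∖Q∖P² = count-∖ P∖Q? (p * p ∣?_) n (trans #P∖Q (cong (_* q′) (sym (suc-pred p)))) #P∖Q∩P²

  module _ (S : Subset n) where

    P∖Q-size : Represents S P∖Q → ∣ S ∣ ≡ e₁
    P∖Q-size rep = trans (∣S∣≡count S P∖Q? rep) #P∖Q

    pq∪Q∖P-size : ∀ {d} → d < n → p ∣ d → Represents S ((_≡ d) ∪ Q∖P) → ∣ S ∣ ≡ e₂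
    pq∪Q∖P-size {d} d<n p∣d rep = begin
      ∣ S ∣                           ≡⟨ ∣S∣≡count S ((_≟ d) ∪? Q∖P?) rep ⟩
      count ((_≟ d) ∪? Q∖P?) n        ≡⟨ count-∪ (_≟ d) Q∖P? disjoint n ⟩
      count (_≟ d) n + count Q∖P? n   ≡⟨ cong₂ _+_ (count-singleton d<n) #Q∖P ⟩
      suc (p * p′)                    ∎
      where
      open ≡-Reasoning
      disjoint : (_≡ d) ⊥ Q∖P
      disjoint (refl , _ , ¬p∣d) = ¬p∣d p∣d

    P∖Q∖P²∪Q∖P-size : Represents S (P∖Q∖P² ∪ Q∖P) → ∣ S ∣ ≡ e₃
    P∖Q∖P²∪Q∖P-size rep = begin
      ∣ S ∣                               ≡⟨ ∣S∣≡count S (P∖Q∖P²? ∪? Q∖P?) rep ⟩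
      count (P∖Q∖P²? ∪? Q∖P?) n           ≡⟨ count-∪ P∖Q∖P²? Q∖P? disjoint n ⟩
      count P∖Q∖P²? n + count Q∖P? n      ≡⟨ cong₂ _+_ #P∖Q∖P² #Q∖P ⟩
      p′ * q′ + p * p′                    ∎
      where
      open ≡-Reasoning
      disjoint : P∖Q∖P² ⊥ Q∖P
      disjoint (((p∣x , _) , _) , _ , ¬p∣x) = ¬p∣x p∣x

    independentDominating-size : IsIndependentDominating n S → ∣ S ∣ ≡ e₁ ⊎ ∣ S ∣ ≡ e₂ ⊎ ∣ S ∣ ≡ e₃
    independentDominating-size ids =
      Sum.map P∖Q-size (Sum.map (λ (d , p∣d , rep) → pq∪Q∖P-size (toℕ<n d) p∣d rep) P∖Q∖P²∪Q∖P-size)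
        (Classification.classification ids)

    private
      dominated-by : ∀ {G : Pred ℕ 0ℓ} → Represents S G →
                     ∀ {x} {v : Fin n} → x < n → G x → n ∣ x * toℕ v → ∃[ s ] s ∈ˢ S × n ∣ toℕ s * toℕ v
      dominated-by {G} rep {v = v} = represented-element {S = S} {P = G} {Q = λ y → n ∣ y * toℕ v} rep

    P∖Q-independentDominating : Represents S P∖Q → IsIndependentDominating n S
    P∖Q-independentDominating rep = record
      { vertices = λ {a} a∈ → let (p∣a , ¬q∣a) = to (rep a) a∈ in from vertex⇔ (∤⇒≢0 ¬q∣a , inj₁ p∣a)
      ; independent = λ {a} {b} a∈ b∈ n∣ab → ⊥-elim
          (proj₂ (to (rep b) b∈) (prime∣*∧∤⇒∣ q-prime (m*n∣⇒n∣ (p * p) q n∣ab) (proj₂ (to (rep a) a∈))))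
      ; dominating = dominating
      }
      where
      -- p² lies in the set and annihilates every multiple of q
      dominating : ∀ {v} → Vertex n v → ¬ v ∈ˢ S → ∃[ s ] s ∈ˢ S × n ∣ toℕ s * toℕ v
      dominating {v} vv v∉ with q ∣? toℕ v
      ... | yes q∣v = dominated-by {P∖Q} rep p²<n (m∣m*n p , q∤p²)
                        (p²∣∧q∣⇒n∣ (∣m⇒∣m*n (toℕ v) ∣-refl) (∣n⇒∣m*n (p * p) q∣v))
      ... | no ¬q∣v = contradiction (from (rep v) (p∣v , ¬q∣v)) v∉
        where p∣v = [ (λ p∣v → p∣v) , (λ q∣v → contradiction q∣v ¬q∣v) ] (proj₂ (to vertex⇔ vv))

    P∖Q∖P²∪Q∖P-independentDominating : Represents S (P∖Q∖P² ∪ Q∖P) → IsIndependentDominating n S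
    P∖Q∖P²∪Q∖P-independentDominating rep = record
      { vertices = λ {a} a∈ → from vertex⇔ (vertex (to (rep a) a∈))
      ; independent = λ {a} {b} a∈ b∈ n∣ab → ⊥-elim (nonadjacent (to (rep a) a∈) (to (rep b) b∈) n∣ab)
      ; dominating = dominating
      }
      where
      vertex : ∀ {x} → (P∖Q∖P² ∪ Q∖P) x → x ≢ 0 × ((p ∣ x) ⊎ (q ∣ x))
      vertex (inj₁ ((p∣x , ¬q∣x) , _)) = ∤⇒≢0 ¬q∣x , inj₁ p∣x
      vertex (inj₂ (q∣x , ¬p∣x)) = ∤⇒≢0 ¬p∣x , inj₂ q∣x

      nonadjacent : ∀ {x y} → (P∖Q∖P² ∪ Q∖P) x → (P∖Q∖P² ∪ Q∖P) y → ¬ n ∣ x * y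
      nonadjacent (inj₁ ((_ , ¬q∣x) , _)) (inj₁ ((_ , ¬q∣y) , _)) n∣xy =
        ¬q∣y (prime∣*∧∤⇒∣ q-prime (m*n∣⇒n∣ (p * p) q n∣xy) ¬q∣x)
      nonadjacent (inj₁ (_ , ¬p²∣x)) (inj₂ (_ , ¬p∣y)) n∣xy = ¬p²∣x (p∤⇒p²∣ann n∣xy ¬p∣y)
      nonadjacent {x} {y} (inj₂ (_ , ¬p∣x)) (inj₁ (_ , ¬p²∣y)) n∣xy =
        ¬p²∣y (p∤⇒p²∣ann (subst (n ∣_) (*-comm x y) n∣xy) ¬p∣x)
      nonadjacent (inj₂ (_ , ¬p∣x)) (inj₂ (_ , ¬p∣y)) n∣xy =
        ¬p∣y (prime∣*∧∤⇒∣ p-prime (m*n∣⇒m∣ p p (m*n∣⇒m∣ (p * p) q n∣xy)) ¬p∣x)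

      -- q annihilates the residues of gcd p², and p those of gcd pq
      dominating : ∀ {v} → Vertex n v → ¬ v ∈ˢ S → ∃[ s ] s ∈ˢ S × n ∣ toℕ s * toℕ v
      dominating {v} vv v∉ with kind (toℕ v)
      ... | gcd-n v≡0 = contradiction v≡0 (proj₁ vv)
      ... | gcd-1 ¬p∣v ¬q∣v = contradiction (proj₂ (to vertex⇔ vv)) [ ¬p∣v , ¬q∣v ]
      ... | gcd-p p∣v ¬p²∣v ¬q∣v = contradiction (from (rep v) (inj₁ ((p∣v , ¬q∣v) , ¬p²∣v))) v∉
      ... | gcd-q ¬p∣v q∣v = contradiction (from (rep v) (inj₂ (q∣v , ¬p∣v))) v∉
      ... | gcd-p² p²∣v _ = dominated-by {P∖Q∖P² ∪ Q∖P} rep q<n (inj₂ (∣-refl , p∤q))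
                              (p²∣∧q∣⇒n∣ (∣n⇒∣m*n q p²∣v) (∣m⇒∣m*n (toℕ v) ∣-refl))
      ... | gcd-pq p∣v q∣v _ = dominated-by {P∖Q∖P² ∪ Q∖P} rep p<n (inj₁ ((∣-refl , q∤p) , p²∤p))
                                 (p²∣∧q∣⇒n∣ (*-pres-∣ (∣-refl {p}) p∣v) (∣n⇒∣m*n p q∣v))

  support : ∀ k → dᵢ n k ≢ 0 → k ≡ e₁ ⊎ k ≡ e₂ ⊎ k ≡ e₃
  support k dᵢ≢0 with to (dᵢ≢0⇔ n k) dᵢ≢0
  ... | S , ids , refl = independentDominating-size S (to (T-isIndepDom S) ids)

  dᵢ[e₁]≢0 : dᵢ n e₁ ≢ 0
  dᵢ[e₁]≢0 = let (S , rep) = represent P∖Q? in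
    subst (λ k → dᵢ n k ≢ 0) (P∖Q-size S rep) (independentDominating⇒dᵢ≢0 (P∖Q-independentDominating S rep))

  dᵢ[e₃]≢0 : dᵢ n e₃ ≢ 0
  dᵢ[e₃]≢0 = let (S , rep) = represent (P∖Q∖P²? ∪? Q∖P?) in
    subst (λ k → dᵢ n k ≢ 0) (P∖Q∖P²∪Q∖P-size S rep)
      (independentDominating⇒dᵢ≢0 (P∖Q∖P²∪Q∖P-independentDominating S rep))

  private
    q′<p′ : q′ < p′
    q′<p′ = pred-mono-< q<p

    1≤q′ : 1 ≤ q′
    1≤q′ = pred-mono-≤ 1<q

    p′≢3 : p′ ≢ 3
    p′≢3 p′≡3 = composite⇒¬prime composite[4] (subst Prime (trans (sym (suc-pred p)) (cong suc p′≡3)) p-prime)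

  2+e₁<e₂ : 2 + e₁ < e₂
  2+e₁<e₂ = s≤s (begin
    2 + p * q′   ≤⟨ +-monoˡ-≤ (p * q′) 1<p ⟩
    p + p * q′   ≡⟨ *-suc p q′ ⟨
    p * suc q′   ≤⟨ *-monoʳ-≤ p q′<p′ ⟩
    p * p′       ∎)
    where open ≤-Reasoning

  e₂<e₃ : e₂ < e₃
  e₂<e₃ = +-monoˡ-< (p * p′) (*-mono-≤ (≤-trans (s≤s 1≤q′) q′<p′) 1≤q′)

  -- e₃ − e₂ = (p − 1)(q − 1) − 1
  e₃≢2+e₂ : e₃ ≢ 2 + e₂
  e₃≢2+e₂ e₃≡3+pp′ = m*k≢3 1≤q′ q′<p′ p′≢3 (+-cancelʳ-≡ (p * p′) (p′ * q′) 3 e₃≡3+pp′)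

proposition3 : (p q : ℕ) → Prime p → Prime q → q < p →
    LogConcave (dᵢ (p * p * q)) × ¬ Unimodal (dᵢ (p * p * q))
proposition3 p q p-prime q-prime q<p = logConcave , ¬unimodal dᵢ[e₁]≢0 dᵢ[e₃]≢0
  where
  open ZeroDivisorGraph p-prime q-prime q<p
  open ThreeTerm support 2+e₁<e₂ e₂<e₃ e₃≢2+e₂
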